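{- Let $\mathcal{P}$ be a well-formed integer program and let $\alpha\in\mathcal{P}$. Let $\alpha'$ be the rule with the same left-hand side, cost and guard as $\alpha$ but with $\mathrm{rhs}(\alpha')\subset\mathrm{rhs}(\alpha)$ (a proper sub-multiset), and let $\mathcal{P}'=\mathcal{P}\cup\{\alpha'\}$. Then $\mathcal{P}'$ is well formed and the processor mapping $\mathcal{P}$ to $\mathcal{P}'$ is sound.
   Context: Fix a finite set $\Sigma$ of function symbols of common arity $k$ containing a start symbol $f_0$, and variables ranging over $\mathbb{Z}$. A rule has the form $f(\vec x)\xrightarrow{c}T\ [\varphi]$ where $\vec x$ is a fixed vector of pairwise different program variables, $f\in\Sigma$, $c$ an arithmetic expression (cost), $T$ a finite multiset of terms $g(t_1,\dots,t_k)$ ($g\in\Sigma$, $t_i$ arithmetic expressions), $\varphi$ a finite conjunction of inequations between arithmetic expressions (guard). An integer program is a finite set of rules in which $f_0$ does not occur on right-hand sides. An integer substitution maps variables of its domain to integers; $\sigma\models\alpha$ means all variables of $\alpha$ are in $\mathrm{dom}(\sigma)$ and $\sigma$ models the guard. A configuration is a finite multiset of terms $f(n_1,\dots,n_k)$, $n_i\in\mathbb{Z}$. $S\xrightarrow{k}_{\mathcal{P}}T$ if there are $s\in S$, a rule $f(\vec x)\xrightarrow{c}Q\ [\varphi]$ in $\mathcal{P}$ and an integer substitution $\sigma$ covering the rule's variables with $f(\vec x)\sigma=s$, $\sigma\models\varphi$, $c\sigma=k$, $T=(S\setminus\{s\})\cup Q\sigma$ (multisets, equality modulo arithmetic); costs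 of sequences are summed. $\mathrm{dh}_{\mathcal{P}}(S)=\sup\{k\mid S\xrightarrow{k}{}^{*}_{\mathcal{P}}T\}$, $\mathrm{rc}_{\mathcal{P}}(n)=\sup\{\mathrm{dh}_{\mathcal{P}}(f_0(\vec n))\mid\vec n\in\mathbb{Z}^k,\sum_i|n_i|\leq n\}$. A rule $\alpha$ is well formed if $t_i\sigma\in\mathbb{Z}$ for all $f(t_1,\dots,t_k)\in\mathrm{rhs}(\alpha)$, all $i$ and all integer $\sigma\models\alpha$; a program is well formed if all its rules are. A processor is a partial function on integer programs; it is sound if $\mathrm{rc}_{\mathcal{P}}(n)\geq\mathrm{rc}_{\mathrm{proc}(\mathcal{P})}(n)$ for all $n\in\mathbb{N}$ and all $\mathcal{P}$ where it is defined. -}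

module Defs where

open import Data.Nat using (ℕ; suc)
import Data.Nat as ℕ
open import Data.Integer as ℤ using (ℤ; ∣_∣; +_)
open import Data.Rational as ℚ using (ℚ)
open import Data.Fin using (Fin)
open import Data.Vec using (Vec; lookup; toList)
open import Data.List using (List; []; _∷_; _++_; map)
open import Data.Nat.ListAction using (sum)
open import Data.List.Relation.Unary.All using (All)
open import Data.List.Relation.Unary.Unique.Propositional using (Unique)
open import Data.List.Relation.Binary.Permutation.Propositional using (_↭_)
open import Data.List.Membership.Propositional using (_∈_)
open import Data.Product using (Σ; ∃; ∃-syntax; _×_; _,_)
open import Relation.Binary.PropositionalEquality using (_≡_; _≢_)
open import Relation.Nullary using (¬_)

Var : Set
Var = ℕ

-- Arithmetic expressions over the variables: integer constants,
-- variables, +, unary minus, *, and division by a positive integer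
-- constant (so expressions may evaluate to non-integer rationals,
-- which is what makes "well formed" a non-trivial condition).
data Expr : Set where
  var   : Var → Expr
  const : ℤ → Expr
  _⊕_   : Expr → Expr → Expr
  ⊖_    : Expr → Expr
  _⊗_   : Expr → Expr → Expr
  _⊘suc_ : Expr → ℕ → Expr     -- e ⊘suc d  denotes  e / (d + 1)

Subst : Set
Subst = Var → ℤ

toℚ : ℤ → ℚ
toℚ n = n ℚ./ 1

⟦_⟧ : Expr → Subst → ℚ
⟦ var x ⟧ σ = toℚ (σ x)
⟦ const n ⟧ σ = toℚ n
⟦ e ⊕ f ⟧ σ = ⟦ e ⟧ σ ℚ.+ ⟦ f ⟧ σ
⟦ ⊖ e ⟧ σ = ℚ.- ⟦ e ⟧ σ
⟦ e ⊗ f ⟧ σ = ⟦ e ⟧ σ ℚ.* ⟦ f ⟧ σ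
⟦ e ⊘suc d ⟧ σ = ⟦ e ⟧ σ ℚ.* (+ 1 ℚ./ suc d)

_[_]≈_ : Expr → Subst → ℤ → Set
e [ σ ]≈ n = ⟦ e ⟧ σ ≡ toℚ n

data Constraint : Set where
  _≤ᶜ_ : Expr → Expr → Constraint
  _<ᶜ_ : Expr → Expr → Constraint

_⊨ᶜ_ : Subst → Constraint → Set
σ ⊨ᶜ (e ≤ᶜ f) = ⟦ e ⟧ σ ℚ.≤ ⟦ f ⟧ σ
σ ⊨ᶜ (e <ᶜ f) = ⟦ e ⟧ σ ℚ.< ⟦ f ⟧ σ

Guard : Set
Guard = List Constraint

_⊨_ : Subst → Guard → Set
σ ⊨ φ = All (σ ⊨ᶜ_) φ

-- Integer programs, parametrised by the number s of function symbols
-- (Σ = Fin s), the common arity k, the start symbol f₀ and the fixed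
-- vector x⃗ of pairwise different program variables.

module IntegerPrograms (s k : ℕ) (f₀ : Fin s) (x⃗ : Vec Var k)
                       (x⃗-distinct : Unique (toList x⃗)) where

  Sym : Set
  Sym = Fin s

  record Term : Set where
    constructor _⦅_⦆
    field
      sym  : Sym
      args : Vec Expr k

  -- f(x⃗) --c--> T [φ];  T is a finite multiset, represented as a list
  record Rule : Set where
    constructor rule
    field
      lhs   : Sym
      cost  : Expr
      rhs   : List Term
      guard : Guard
  open Rule public

  Program : Set
  Program = List Rule

  IsIntegerProgram : Program → Set
  IsIntegerProgram P = ∀ {α} → α ∈ P → ∀ {t} → t ∈ rhs α → Term.sym t ≢ f₀

  WellFormedRule : Rule → Set
  WellFormedRule α = ∀ (σ : Subst) → σ ⊨ guard α →
    ∀ {t} → t ∈ rhs α → ∀ (i : Fin k) → ∃[ n ] (lookup (Term.args t) i [ σ ]≈ n)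

  WellFormed : Program → Set
  WellFormed P = ∀ {α} → α ∈ P → WellFormedRule α

  -- configurations: finite multisets of ground terms f(n₁,…,n_k)
  GTerm : Set
  GTerm = Sym × Vec ℤ k

  Config : Set
  Config = List GTerm

  _[_]ᵗ≈_ : Term → Subst → GTerm → Set
  t [ σ ]ᵗ≈ (g , ns) =
    Term.sym t ≡ g × (∀ (i : Fin k) → lookup (Term.args t) i [ σ ]≈ lookup ns i)

  -- Q σ = Q' (as lists, hence as multisets up to the permutation below)
  data _[_]ˡ≈_ : List Term → Subst → Config → Set where
    []  : ∀ {σ} → [] [ σ ]ˡ≈ []
    _∷_ : ∀ {σ t u Q Q'} → t [ σ ]ᵗ≈ u → Q [ σ ]ˡ≈ Q' → (t ∷ Q) [ σ ]ˡ≈ (u ∷ Q')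

  record Step (P : Program) (S : Config) (c : ℤ) (T : Config) : Set where
    field
      redex    : GTerm
      rest     : Config
      split    : S ↭ redex ∷ rest
      α        : Rule
      α∈P      : α ∈ P
      σ        : Subst
      lhs-eq   : lhs α ≡ Data.Product.proj₁ redex
      args-eq  : ∀ (i : Fin k) → σ (lookup x⃗ i) ≡ lookup (Data.Product.proj₂ redex) i
      guard-ok : σ ⊨ guard α
      cost-eq  : cost α [ σ ]≈ c
      Qσ       : Config
      inst     : rhs α [ σ ]ˡ≈ Qσ
      result   : T ↭ rest ++ Qσ

  data Steps (P : Program) : Config → ℤ → Config → Set where
    done : ∀ {S} → Steps P S (+ 0) S
    step : ∀ {S c U d T} → Step P S c U → Steps P U d T → Steps P S (c ℤ.+ d) T

  ∥_∥ : Vec ℤ k → ℕ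
  ∥ ns ∥ = sum (map ∣_∣ (toList ns))

  start : Vec ℤ k → Config
  start ns = (f₀ , ns) ∷ []

  -- dh_P(S) ≥ c  (i.e. c ≤ sup{ c' | S -->* T }, with integer costs)
  DhGe : Program → Config → ℤ → Set
  DhGe P S c = ∃[ c' ] ∃[ T ] (c ℤ.≤ c' × Steps P S c' T)

  -- rc_{P'}(n) ≤ rc_P(n): every value in the set whose supremum is
  -- rc_{P'}(n) is bounded by rc_P(n), i.e. by some element of the set
  -- whose supremum is rc_P(n) (all sets of integers).
  RcLe : Program → Program → ℕ → Set
  RcLe P' P n = ∀ (ns : Vec ℤ k) → ∥ ns ∥ ℕ.≤ n → ∀ {c T} → Steps P' (start ns) c T →
    ∃[ ms ] (∥ ms ∥ ℕ.≤ n × DhGe P (start ms) c)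

  _⊂ₘ_ : List Term → List Term → Set
  Q' ⊂ₘ Q = ∃[ R ] (Q ↭ Q' ++ R × R ≢ [])

module Submission where

-- Well-formedness of α' is immediate, since its right-hand side terms
-- all occur in rhs α.  For soundness we simulate every run of α' ∷ P by
-- a run of P with the same cost: a step with α' is replayed with α, and
-- the instances of the dropped terms R (which exist because α is well
-- formed) are carried along as an inert surplus E of the configuration.

open import Defs
open import Data.Nat using (ℕ)
open import Data.Fin using (Fin)
open import Data.Vec using (Vec; toList; tabulate; lookup)
open import Data.Vec.Properties using (lookup∘tabulate)
open import Data.List using (List; []; _∷_; _++_)
open import Data.List.Properties using (++-assoc; ++-identityʳ)
open import Data.List.Relation.Unary.Unique.Propositional using (Unique)
open import Data.List.Relation.Unary.Any using (here; there)
open import Data.List.Membership.Propositional using (_∈_)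
open import Data.List.Membership.Propositional.Properties using (∈-++⁺ˡ; ∈-++⁺ʳ)
open import Data.List.Relation.Binary.Permutation.Propositional
open import Data.List.Relation.Binary.Permutation.Propositional.Properties
  using (∈-resp-↭; ++⁺ˡ; ++⁺ʳ; ++-comm)
open import Data.Product using (_×_; _,_; proj₁; proj₂; ∃-syntax)
open import Data.Integer using (ℤ)
open import Data.Integer.Properties using (≤-refl)
open import Relation.Binary.PropositionalEquality as ≡ using (_≡_; subst)

module Truncation (s k : ℕ) (f₀ : Fin s) (x⃗ : Vec Var k) (x⃗-distinct : Unique (toList x⃗)) where
  open IntegerPrograms s k f₀ x⃗ x⃗-distinct

  _≼_ : Rule → Rule → Set
  α' ≼ α = lhs α' ≡ lhs α × cost α' ≡ cost α × guard α' ≡ guard α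
         × ∃[ R ] (rhs α ↭ rhs α' ++ R)

  -- Well-formedness of a rule only depends on its guard and on which
  -- terms occur on its right-hand side.
  ≼-wellFormed : ∀ {α α'} → α' ≼ α → WellFormedRule α → WellFormedRule α'
  ≼-wellFormed (_ , _ , same-guard , R , rhs↭) wfα σ σ⊨φ t∈rhs =
    wfα σ (subst (σ ⊨_) same-guard σ⊨φ) (∈-resp-↭ (↭-sym rhs↭) (∈-++⁺ˡ t∈rhs))

  wellFormed-∷ : ∀ {α P} → WellFormedRule α → WellFormed P → WellFormed (α ∷ P)
  wellFormed-∷ wfα wfP (here ≡.refl) = wfα
  wellFormed-∷ wfα wfP (there α∈P)   = wfP α∈P

  IntegralUnder : Subst → Term → Set
  IntegralUnder σ t = ∀ (i : Fin k) → ∃[ n ] (lookup (Term.args t) i [ σ ]≈ n)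

  instantiate-term : ∀ σ t → IntegralUnder σ t → ∃[ u ] (t [ σ ]ᵗ≈ u)
  instantiate-term σ t integral =
      (Term.sym t , tabulate value)
    , ≡.refl
    , λ i → subst (lookup (Term.args t) i [ σ ]≈_) (≡.sym (lookup∘tabulate value i))
                  (proj₂ (integral i))
    where
    value : Fin k → ℤ
    value i = proj₁ (integral i)

  instantiate : ∀ σ (Q : List Term) → (∀ {t} → t ∈ Q → IntegralUnder σ t) →
                ∃[ C ] (Q [ σ ]ˡ≈ C)
  instantiate σ []      integral = [] , []
  instantiate σ (t ∷ Q) integral
    with instantiate-term σ t (integral (here ≡.refl))
       | instantiate σ Q (λ t∈Q → integral (there t∈Q))
  ... | u , t≈u | C , Q≈C = u ∷ C , t≈u ∷ Q≈C

  inst-++ : ∀ {σ Q₁ Q₂ C₁ C₂} → Q₁ [ σ ]ˡ≈ C₁ → Q₂ [ σ ]ˡ≈ C₂ →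
            (Q₁ ++ Q₂) [ σ ]ˡ≈ (C₁ ++ C₂)
  inst-++ []          Q₂≈C₂ = Q₂≈C₂
  inst-++ (t≈u ∷ Q≈C) Q₂≈C₂ = t≈u ∷ inst-++ Q≈C Q₂≈C₂

  inst-↭ : ∀ {σ Q Q₁ C₁} → Q ↭ Q₁ → Q₁ [ σ ]ˡ≈ C₁ → ∃[ C ] (Q [ σ ]ˡ≈ C × C ↭ C₁)
  inst-↭ refl Q≈C = _ , Q≈C , refl
  inst-↭ (prep t Q↭) (t≈u ∷ Q≈C) with inst-↭ Q↭ Q≈C
  ... | _ , Q≈C' , C↭ = _ , t≈u ∷ Q≈C' , prep _ C↭
  inst-↭ (swap t t' Q↭) (t≈u ∷ t'≈u' ∷ Q≈C) with inst-↭ Q↭ Q≈C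
  ... | _ , Q≈C' , C↭ = _ , t'≈u' ∷ t≈u ∷ Q≈C' , swap _ _ C↭
  inst-↭ (trans Q↭Q₂ Q₂↭Q₁) Q₁≈C₁ with inst-↭ Q₂↭Q₁ Q₁≈C₁
  ... | _ , Q₂≈C₂ , C₂↭ with inst-↭ Q↭Q₂ Q₂≈C₂
  ... | _ , Q≈C , C↭ = _ , Q≈C , trans C↭ C₂↭

  -- A step is determined by its redex, rule, substitution and instance;
  -- the surrounding configuration and the program containing the rule
  -- may be exchanged.
  recontext : ∀ {P P' S S' c U U'} (st : Step P S c U) (rest' : Config) →
              S' ↭ Step.redex st ∷ rest' → Step.α st ∈ P' →
              U' ↭ rest' ++ Step.Qσ st → Step P' S' c U'
  recontext st rest' split' α∈P' result' = record
    { redex = redex ; rest = rest' ; split = split' ; α = α ; α∈P = α∈P' ; σ = σ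
    ; lhs-eq = lhs-eq ; args-eq = args-eq ; guard-ok = guard-ok ; cost-eq = cost-eq
    ; Qσ = Qσ ; inst = inst ; result = result' }
    where open Step st using (redex; α; σ; lhs-eq; args-eq; guard-ok; cost-eq; Qσ; inst)

  step-to-↭ : ∀ {P S c U U'} → U' ↭ U → Step P S c U → Step P S c U'
  step-to-↭ U'↭U st =
    recontext st (Step.rest st) (Step.split st) (Step.α∈P st) (↭-trans U'↭U (Step.result st))

  step-frame : ∀ {P S c U} E → Step P S c U → Step P (S ++ E) c (U ++ E)
  step-frame {U = U} E st =
    recontext st (rest ++ E) (++⁺ʳ E split) (Step.α∈P st) result-framed
    where
    open Step st using (rest; split; Qσ; result)
    open PermutationReasoning
    result-framed : U ++ E ↭ (rest ++ E) ++ Qσ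
    result-framed = begin
      U ++ E             ↭⟨ ++⁺ʳ E result ⟩
      (rest ++ Qσ) ++ E  ≡⟨ ++-assoc rest Qσ E ⟩
      rest ++ (Qσ ++ E)  ↭⟨ ++⁺ˡ rest (++-comm Qσ E) ⟩
      rest ++ (E ++ Qσ)  ≡⟨ ≡.sym (++-assoc rest E Qσ) ⟩
      (rest ++ E) ++ Qσ  ∎

  -- A step with a truncation α' of α can be replayed with α; the result
  -- then additionally contains the instances of the dropped terms.
  step-untruncate : ∀ {P Q S c U α α'} → α ∈ P → WellFormedRule α → α' ≼ α →
                    (st : Step Q S c U) → Step.α st ≡ α' → ∃[ E ] Step P S c (U ++ E)
  step-untruncate {c = c} {U} {α} α∈P wfα
                  (same-lhs , same-cost , same-guard , R , rhs↭) st ≡.refl =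
    Rσ , record
      { redex = redex ; rest = rest ; split = split ; α = α ; α∈P = α∈P ; σ = σ
      ; lhs-eq = ≡.trans (≡.sym same-lhs) lhs-eq ; args-eq = args-eq
      ; guard-ok = guard-α ; cost-eq = subst (_[ σ ]≈ c) same-cost cost-eq
      ; Qσ = Qσ⁺ ; inst = rhs≈Qσ⁺ ; result = result⁺ }
    where
    open Step st using (redex; rest; split; σ; lhs-eq; args-eq; guard-ok; cost-eq; Qσ; inst; result)
    guard-α : σ ⊨ guard α
    guard-α = subst (σ ⊨_) same-guard guard-ok

    dropped-instance : ∃[ C ] (R [ σ ]ˡ≈ C)
    dropped-instance = instantiate σ R λ t∈R →
      wfα σ guard-α (∈-resp-↭ (↭-sym rhs↭) (∈-++⁺ʳ _ t∈R))
    Rσ = proj₁ dropped-instance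

    rhs-instance : ∃[ C ] (rhs α [ σ ]ˡ≈ C × C ↭ Qσ ++ Rσ)
    rhs-instance = inst-↭ rhs↭ (inst-++ inst (proj₂ dropped-instance))
    Qσ⁺ = proj₁ rhs-instance
    rhs≈Qσ⁺ = proj₁ (proj₂ rhs-instance)

    open PermutationReasoning
    result⁺ : U ++ Rσ ↭ rest ++ Qσ⁺
    result⁺ = begin
      U ++ Rσ             ↭⟨ ++⁺ʳ Rσ result ⟩
      (rest ++ Qσ) ++ Rσ  ≡⟨ ++-assoc rest Qσ Rσ ⟩
      rest ++ (Qσ ++ Rσ)  ↭⟨ ++⁺ˡ rest (↭-sym (proj₂ (proj₂ rhs-instance))) ⟩
      rest ++ Qσ⁺         ∎

  simulate-step : ∀ {P S c U α α'} → α ∈ P → WellFormedRule α → α' ≼ α →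
                  Step (α' ∷ P) S c U → ∃[ E ] Step P S c (U ++ E)
  simulate-step α∈P wfα α'≼α st with Step.α∈P st
  ... | here rule≡α' = step-untruncate α∈P wfα α'≼α st rule≡α'
  ... | there rule∈P =
    [] , recontext st (Step.rest st) (Step.split st) rule∈P
                   (↭-trans (↭-reflexive (++-identityʳ _)) (Step.result st))

  simulate : ∀ {P S c T α α'} → α ∈ P → WellFormedRule α → α' ≼ α →
             Steps (α' ∷ P) S c T → ∀ E → ∃[ T' ] Steps P (S ++ E) c T'
  simulate α∈P wfα α'≼α done E = _ , done
  simulate α∈P wfα α'≼α (step {U = U} st run) E
    with simulate-step α∈P wfα α'≼α st
  ... | E' , st' with simulate α∈P wfα α'≼α run (E' ++ E)
  ... | T' , run' =
    T' , step (step-to-↭ (↭-reflexive (≡.sym (++-assoc U E' E))) (step-frame E st')) run'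

  ≼-sound : ∀ {P α α'} → α ∈ P → WellFormedRule α → α' ≼ α → ∀ n → RcLe (α' ∷ P) P n
  ≼-sound α∈P wfα α'≼α n ns ∥ns∥≤n {c} run =
    let T' , run' = simulate α∈P wfα α'≼α run [] in
    ns , ∥ns∥≤n , c , T' , ≤-refl , run'

theorem4p7 : (s k : ℕ) (f₀ : Fin s) (x⃗ : Vec Var k) (x⃗-distinct : Unique (toList x⃗)) →
    let open IntegerPrograms s k f₀ x⃗ x⃗-distinct in
    (P : Program) → IsIntegerProgram P → WellFormed P →
    (α : Rule) → α ∈ P →
    (α' : Rule) → lhs α' ≡ lhs α → cost α' ≡ cost α → guard α' ≡ guard α →
    rhs α' ⊂ₘ rhs α →
    WellFormed (α' ∷ P) × (∀ (n : ℕ) → RcLe (α' ∷ P) P n)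
theorem4p7 s k f₀ x⃗ x⃗-distinct P _ wfP α α∈P α' same-lhs same-cost same-guard (R , rhs↭ , _) =
  wellFormed-∷ (≼-wellFormed α'≼α wfα) wfP , ≼-sound α∈P wfα α'≼α
  where
  open Truncation s k f₀ x⃗ x⃗-distinct
  α'≼α : α' ≼ α
  α'≼α = same-lhs , same-cost , same-guard , R , rhs↭
  wfα = wfP α∈P
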